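{- Let $k,\ell$ be integers with $0 < 2\ell \leq k$, and let $e_1,\dots,e_t$ be positive integers. Then \[ R_<\big(P_{e_1}^{k,\ell}, \dots, P_{e_t}^{k,\ell}\big) = (k-\ell)\prod_{i=1}^t e_i + \ell. \]
   Context: An ordered $k$-uniform hypergraph is a $k$-uniform hypergraph with a totally ordered vertex set. An ordered hypergraph $G$ is contained in an ordered hypergraph $H$ if there is an injective order-preserving map $V(G)\to V(H)$ sending every edge of $G$ to an edge of $H$. $K_N^k$ is the complete $k$-uniform hypergraph on $[N]=\{1,\dots,N\}$ with the natural order. For ordered $k$-uniform hypergraphs $G_1,\dots,G_t$, the ordered Ramsey number $R_<(G_1,\dots,G_t)$ is the least $N$ such that for every coloring $c:E(K_N^k)\to[t]$ there is a color $j$ such that the hypergraph formed by the edges of color $j$ contains $G_j$. For integers $k>\ell\ge 0$ and $e\ge1$, the path $P_e^{k,\ell}$ is the ordered $k$-uniform hypergraph on vertex set $[e(k-\ell)+\ell]$ with edges $A_r=\{(r-1)(k-\ell)+1,\dots,(r-1)(k-\ell)+k\}$ for $r=1,\dots,e$. -}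

module Defs where

open import Data.Nat using (ℕ; zero; suc; _+_; _*_; _∸_; _<_)
import Data.Fin as Fin
open import Data.Fin using (Fin; toℕ) renaming (_<_ to _<ᶠ_)
open import Data.Vec using (Vec; []; _∷_; map; lookup)
open import Data.Unit using (⊤)
open import Data.Product using (Σ; _×_)
open import Relation.Binary.PropositionalEquality using (_≡_)
open import Relation.Nullary using (¬_)

-- A vector of vertices is strictly increasing; a k-element subset of [n]
-- is represented canonically by its increasing enumeration.
Increasing : ∀ {n k} → Vec (Fin n) k → Set
Increasing [] = ⊤
Increasing (x ∷ []) = ⊤
Increasing (x ∷ y ∷ v) = (x <ᶠ y) × Increasing (y ∷ v)

-- Ordered k-uniform hypergraph on vertex set Fin size (natural order).
-- Its edges are the increasing vectors v with Edge v.
record OHG (k : ℕ) : Set₁ where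
  field
    size : ℕ
    Edge : Vec (Fin size) k → Set
open OHG public

Contained : ∀ {k} → OHG k → OHG k → Set
Contained {k} G H =
  Σ (Fin (size G) → Fin (size H)) λ f →
    (∀ i j → i <ᶠ j → f i <ᶠ f j) ×
    (∀ (v : Vec (Fin (size G)) k) → Increasing v → Edge G v → Edge H (map f v))

Coloring : ℕ → ℕ → ℕ → Set
Coloring k N t = (v : Vec (Fin N) k) → Increasing v → Fin t

ColorClass : ∀ {k N t} → Coloring k N t → Fin t → OHG k
ColorClass {k} {N} c j = record
  { size = N
  ; Edge = λ v → Σ (Increasing v) λ p → c v p ≡ j }

Arrows : ∀ {k t} → ℕ → (Fin t → OHG k) → Set
Arrows {k} {t} N Gs = ∀ (c : Coloring k N t) → Σ (Fin t) λ j → Contained (Gs j) (ColorClass c j)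

IsOrderedRamsey : ∀ {k t} → (Fin t → OHG k) → ℕ → Set
IsOrderedRamsey Gs R = Arrows R Gs × (∀ N → N < R → ¬ Arrows N Gs)

-- The path P_e^{k,l} (0-indexed vertices): vertex set [e(k-l)+l], edges
-- A_r = {r(k-l), ..., r(k-l)+k-1} for r = 0..e-1.
Path : ℕ → (k : ℕ) → ℕ → OHG k
Path e k l = record
  { size = e * (k ∸ l) + l
  ; Edge = λ v → Σ (Fin e) λ r → ∀ i → toℕ (lookup v i) ≡ toℕ r * (k ∸ l) + toℕ i }

prod : ∀ {t} → (Fin t → ℕ) → ℕ
prod {zero} es = 1
prod {suc t} es = es Fin.zero * prod (λ i → es (Fin.suc i))

module Submission where

-- Put m = k - l.  The edge A_r of P_e^{k,l} starts at r·m and consists of the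
-- block [r·m, r·m + m) followed by the first l ≤ m vertices of the next block,
-- so P_e^{k,l} is a monotone graph path of length e "blown up" by blocks of
-- size m.  Both bounds are therefore reduced to monotone paths in graphs.
--
-- Every colouring of the pairs of more than e_1⋯e_t vertices with t
-- colours has a colour-j monotone path with e_j edges (induction on t and on
-- e_1, splitting the vertices by whether they are the top of a colour-1 edge);
-- conversely the lexicographic product colouring of [e_1⋯e_t] has no such path.
--
-- On m·P + l vertices (P = e_1⋯e_t) colour a pair of blocks
-- x < y ≤ P by the colour of "block x + first l vertices of block y"; a
-- monochromatic graph path a_0 < … < a_e blows up to the embedding
-- q ↦ a(q / m)·m + q % m of P_e^{k,l}.
--
-- On fewer vertices colour a hyperedge lexicographically by the
-- blocks of its 0-th and m-th vertex; an embedding of P_{e_j}^{k,l} in colour j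
-- yields a colour-j lexicographic graph path with e_j edges below P, which is
-- impossible.

open import Defs
open import Data.Nat using (ℕ; zero; suc; _+_; _*_; _∸_; _<_; _≤_; z≤n; s≤s; pred; NonZero; >-nonZero; ≢-nonZero; _<?_; _≟_)
open import Data.Nat.Properties
open import Data.Nat.DivMod using (_/_; _%_; m≡m%n+[m/n]*n; [m+kn]%n≡m%n; m%n<n; m<n⇒m%n≡m; m*n/n≡m; m/n*n≤m; /-monoˡ-≤; m<n⇒m/n≡0; +-distrib-/-∣ˡ; m/n≡1+[m∸n]/n; m<n*o⇒m/o<n)
open import Data.Nat.Divisibility using (divides-refl)
open import Data.Fin using (Fin; toℕ; fromℕ<) renaming (zero to fzero; suc to fsuc)
open import Data.Fin.Properties using (toℕ-fromℕ<; toℕ<n; toℕ-injective)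
import Data.Vec.Functional as Vector
open import Data.Vec using (Vec; []; _∷_; map; lookup; tabulate)
open import Data.Vec.Properties using (lookup-map; lookup∘tabulate; tabulate∘lookup; tabulate-cong)
open import Data.List using (List; []; _∷_; length; filter; downFrom)
open import Data.List.Properties using (length-downFrom)
open import Data.List.Membership.Propositional using (_∈_; find; lose)
open import Data.List.Membership.Propositional.Properties using (∈-filter⁻; ∈-downFrom⁻)
open import Data.List.Relation.Unary.Any using (Any; here; there; any?)
open import Data.List.Relation.Unary.All using (_∷_)
open import Data.List.Relation.Unary.AllPairs using (_∷_)
open import Data.List.Relation.Unary.Unique.Propositional using (Unique)
open import Data.List.Relation.Unary.Unique.Propositional.Properties using (filter⁺; downFrom⁺)
open import Data.Product using (Σ; _×_; _,_; proj₁; proj₂)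
open import Data.Sum using (inj₁; inj₂)
open import Data.Unit using (tt)
open import Data.Empty using (⊥-elim)
open import Relation.Nullary using (¬_; Dec; yes; no; ¬?)
open import Relation.Nullary.Decidable using (_×-dec_)
open import Relation.Unary using (Decidable)
open import Relation.Binary.Definitions using (tri<; tri≈; tri>)
open import Relation.Binary.PropositionalEquality

length-filter-split : ∀ {A : Set} {P : A → Set} (P? : Decidable P) (xs : List A) →
  length (filter P? xs) + length (filter (λ x → ¬? (P? x)) xs) ≡ length xs
length-filter-split P? [] = refl
length-filter-split P? (x ∷ xs) with P? x
... | yes _ = cong suc (length-filter-split P? xs)
... | no _  = trans (+-suc _ _) (cong suc (length-filter-split P? xs))

[q*d+s]/d≡q : ∀ d .{{_ : NonZero d}} q s → s < d → (q * d + s) / d ≡ q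
[q*d+s]/d≡q d q s s<d = begin
    (q * d + s) / d    ≡⟨ +-distrib-/-∣ˡ s (divides-refl q) ⟩
    q * d / d + s / d  ≡⟨ cong₂ _+_ (m*n/n≡m q d) (m<n⇒m/n≡0 s<d) ⟩
    q + 0              ≡⟨ +-identityʳ q ⟩
    q                  ∎
  where open ≡-Reasoning

[q*d+s]%d≡s : ∀ d .{{_ : NonZero d}} q s → s < d → (q * d + s) % d ≡ s
[q*d+s]%d≡s d q s s<d =
  trans (cong (_% d) (+-comm (q * d) s)) (trans ([m+kn]%n≡m%n s q d) (m<n⇒m%n≡m s<d))

[x+d]/d≡1+x/d : ∀ d .{{_ : NonZero d}} x → (x + d) / d ≡ suc (x / d)
[x+d]/d≡1+x/d d x =
  trans (m/n≡1+[m∸n]/n (m≤n+m d x)) (cong (λ z → suc (z / d)) (m+n∸n≡m x d))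

sameBlock⇒%< : ∀ d .{{_ : NonZero d}} {q q'} → q < q' → q / d ≡ q' / d → q % d < q' % d
sameBlock⇒%< d {q} {q'} q<q' same = +-cancelʳ-< (q' / d * d) (q % d) (q' % d)
  (subst₂ _<_ (trans (m≡m%n+[m/n]*n q d) (cong (λ z → q % d + z * d) same))
              (m≡m%n+[m/n]*n q' d) q<q')

Ascending : ℕ → (ℕ → ℕ) → Set
Ascending n y = ∀ r → r < n → y r < y (suc r)

ascending-gap : ∀ (y : ℕ → ℕ) n → Ascending n y → y 0 + n ≤ y n
ascending-gap y zero _ = ≤-reflexive (+-identityʳ (y 0))
ascending-gap y (suc n) asc = begin
    y 0 + suc n    ≡⟨ +-suc (y 0) n ⟩
    suc (y 0 + n)  ≤⟨ s≤s (ascending-gap y n (λ r r<n → asc r (m≤n⇒m≤1+n r<n))) ⟩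
    suc (y n)      ≤⟨ asc n (n<1+n n) ⟩
    y (suc n)      ∎
  where open ≤-Reasoning

ascending⇒n≤ : ∀ {n y} → Ascending n y → n ≤ y n
ascending⇒n≤ {n} {y} asc = ≤-trans (m≤n+m n (y 0)) (ascending-gap y n asc)

ascending⇒< : ∀ {n y i i'} → Ascending n y → i < i' → i' ≤ n → y i < y i'
ascending⇒< {i = i} {suc i'} asc i<1+i' 1+i'≤n with m≤n⇒m<n∨m≡n (≤-pred i<1+i')
... | inj₁ i<i' = <-trans (ascending⇒< asc i<i' (≤-trans (n≤1+n i') 1+i'≤n)) (asc i' 1+i'≤n)
... | inj₂ refl = asc i 1+i'≤n

Chain : (ℕ → ℕ → Set) → ℕ → (ℕ → ℕ) → Set
Chain R n y = ∀ r → r < n → y r < y (suc r) × R (y r) (y (suc r))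

-- Monotone paths in edge-coloured ordered complete graphs, colours being
-- natural numbers; only the colours of pairs u < v matter.
PairColouring : Set
PairColouring = ℕ → ℕ → ℕ

MonoPath : PairColouring → List ℕ → (e j : ℕ) → (ℕ → ℕ) → Set
MonoPath c V e j a = (∀ r → r ≤ e → a r ∈ V) × Chain (λ u v → c u v ≡ j) e a

HasMonoPath : ∀ {t} → (Fin t → ℕ) → PairColouring → List ℕ → Set
HasMonoPath {t} es c V = Σ (Fin t) λ j → Σ (ℕ → ℕ) λ a → MonoPath c V (es j) (toℕ j) a

UsesColours : ℕ → PairColouring → List ℕ → Set
UsesColours t c V = ∀ u v → u ∈ V → v ∈ V → u < v → c u v < t

UsesColours-⊆ : ∀ {t c V W} → (∀ {x} → x ∈ V → x ∈ W) → UsesColours t c W → UsesColours t c V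
UsesColours-⊆ V⊆W uses u v u∈V v∈V = uses u v (V⊆W u∈V) (V⊆W v∈V)

MonoPath-⊆ : ∀ {c V W e j a} → (∀ {x} → x ∈ V → x ∈ W) → MonoPath c V e j a → MonoPath c W e j a
MonoPath-⊆ V⊆W (inV , chain) = (λ r r≤e → V⊆W (inV r r≤e)) , chain

_◂_ : ℕ → (ℕ → ℕ) → ℕ → ℕ
(u ◂ a) zero    = u
(u ◂ a) (suc r) = a r

MonoPath-◂ : ∀ {c V e j a u} → u ∈ V → u < a 0 → c u (a 0) ≡ j →
  MonoPath c V e j a → MonoPath c V (suc e) j (u ◂ a)
MonoPath-◂ {c} {V} {e} {j} {a} {u} u∈V u<a0 cu≡j (inV , chain) = inV' , chain'
  where
  inV' : ∀ r → r ≤ suc e → (u ◂ a) r ∈ V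
  inV' zero    _          = u∈V
  inV' (suc r) (s≤s r≤e) = inV r r≤e
  chain' : Chain (λ x y → c x y ≡ j) (suc e) (u ◂ a)
  chain' zero    _          = u<a0 , cu≡j
  chain' (suc r) (s≤s r<e) = chain r r<e

lowerColours : PairColouring → PairColouring
lowerColours c u v = pred (c u v)

AvoidsColour0 : PairColouring → List ℕ → Set
AvoidsColour0 c V = ∀ u v → u ∈ V → v ∈ V → u < v → c u v ≢ 0

UsesColours-lower : ∀ {t c V} → UsesColours (suc t) c V → AvoidsColour0 c V →
  UsesColours t (lowerColours c) V
UsesColours-lower {t} {c} uses avoids u v u∈V v∈V u<v =
  subst (_≤ t) (sym (suc-pred (c u v) {{≢-nonZero (avoids u v u∈V v∈V u<v)}}))
        (≤-pred (uses u v u∈V v∈V u<v))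

MonoPath-lower : ∀ {c V e j a} → AvoidsColour0 c V →
  MonoPath (lowerColours c) V e j a → MonoPath c V e (suc j) a
MonoPath-lower {c} {V} {e} {j} {a} avoids (inV , chain) = inV , chain'
  where
  chain' : Chain (λ u v → c u v ≡ suc j) e a
  chain' r r<e with chain r r<e
  ... | a<a' , colour = a<a' ,
    trans (sym (suc-pred (c (a r) (a (suc r)))
                 {{≢-nonZero (avoids _ _ (inV r (<⇒≤ r<e)) (inV (suc r) r<e) a<a')}}))
          (cong suc colour)

MonoPathRamsey : ℕ → Set
MonoPathRamsey t = ∀ (es : Fin t → ℕ) c V → Unique V → UsesColours t c V →
  prod es < length V → HasMonoPath es c V

uncolourable : ∀ {c x y V} → Unique (x ∷ y ∷ V) → ¬ UsesColours 0 c (x ∷ y ∷ V)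
uncolourable {x = x} {y} ((x≢y ∷ _) ∷ _) uses with <-cmp x y
... | tri< x<y _ _ = n≮0 (uses x y (here refl) (there (here refl)) x<y)
... | tri≈ _ x≡y _ = x≢y x≡y
... | tri> _ _ y<x = n≮0 (uses y x (there (here refl)) (here refl) y<x)

-- The induction step from t to t + 1 colours, by induction on the length n
-- required in colour 0.  Vertices that are the top of a colour-0 edge ("tops")
-- can extend a colour-0 path backwards; on the remaining vertices colour 0 is
-- absent, so t colours suffice there.
module AddColour (t : ℕ) (IH : MonoPathRamsey t) (c : PairColouring) where

  Colour0Top : List ℕ → ℕ → Set
  Colour0Top V v = Any (λ u → u < v × c u v ≡ 0) V

  colour0Top? : ∀ V → Decidable (Colour0Top V)
  colour0Top? V v = any? (λ u → (u <? v) ×-dec (c u v ≟ 0)) V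

  tops nonTops : List ℕ → List ℕ
  tops V    = filter (colour0Top? V) V
  nonTops V = filter (λ v → ¬? (colour0Top? V v)) V

  tops⊆ : ∀ {V x} → x ∈ tops V → x ∈ V
  tops⊆ {V} x∈ = proj₁ (∈-filter⁻ (colour0Top? V) {xs = V} x∈)

  nonTops⊆ : ∀ {V x} → x ∈ nonTops V → x ∈ V
  nonTops⊆ {V} x∈ = proj₁ (∈-filter⁻ (λ v → ¬? (colour0Top? V v)) {xs = V} x∈)

  nonTops-avoid : ∀ V → AvoidsColour0 c (nonTops V)
  nonTops-avoid V u v u∈ v∈ u<v cuv≡0 =
    proj₂ (∈-filter⁻ (λ w → ¬? (colour0Top? V w)) {xs = V} v∈) (lose (nonTops⊆ u∈) (u<v , cuv≡0))

  many-tops : ∀ n (g : Fin t → ℕ) V → suc n * prod g < length V → ¬ prod g < length (nonTops V) →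
    n * prod g < length (tops V)
  many-tops n g V big few = +-cancelˡ-< (prod g) (n * prod g) (length (tops V)) (begin-strict
      prod g + n * prod g                   <⟨ big ⟩
      length V                              ≡⟨ sym (length-filter-split (colour0Top? V) V) ⟩
      length (tops V) + length (nonTops V)  ≤⟨ +-monoʳ-≤ (length (tops V)) (≮⇒≥ few) ⟩
      length (tops V) + prod g              ≡⟨ +-comm (length (tops V)) (prod g) ⟩
      prod g + length (tops V)              ∎)
    where open ≤-Reasoning

  -- A path among the tops either has a colour ≥ 1, or colour 0 and then it
  -- extends backwards by the colour-0 edge below its first vertex.
  fromTops : ∀ {n} {g : Fin t → ℕ} {V} → HasMonoPath (n Vector.∷ g) c (tops V) →
    HasMonoPath (suc n Vector.∷ g) c V
  fromTops (fsuc j , a , path) = fsuc j , a , MonoPath-⊆ {c = c} tops⊆ path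
  fromTops {V = V} (fzero , a , path) with find (proj₂ (∈-filter⁻ (colour0Top? V) {xs = V} (proj₁ path 0 z≤n)))
  ... | u , u∈V , u<a0 , cu≡0 = fzero , u ◂ a , MonoPath-◂ {c = c} u∈V u<a0 cu≡0 (MonoPath-⊆ {c = c} tops⊆ path)

  extend : ∀ n (g : Fin t → ℕ) V → Unique V → UsesColours (suc t) c V →
    n * prod g < length V → HasMonoPath (n Vector.∷ g) c V
  extend zero g (x ∷ V) _ _ _ = fzero , (λ _ → x) , (λ _ _ → here refl) , λ _ ()
  extend (suc n) g V unique uses big with prod g <? length (nonTops V)
  ... | no few = fromTops {n} {g} {V} (extend n g (tops V) (filter⁺ (colour0Top? V) unique)
                                  (UsesColours-⊆ tops⊆ uses) (many-tops n g V big few))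
  ... | yes enough
    with IH g (lowerColours c) (nonTops V) (filter⁺ (λ v → ¬? (colour0Top? V v)) unique)
            (UsesColours-lower (UsesColours-⊆ nonTops⊆ uses) (nonTops-avoid V)) enough
  ...   | j , a , path = fsuc j , a , MonoPath-⊆ {c = c} nonTops⊆ (MonoPath-lower {c = c} (nonTops-avoid V) path)

head∷tail : ∀ {t} (es : Fin (suc t) → ℕ) j → (Vector.head es Vector.∷ Vector.tail es) j ≡ es j
head∷tail es fzero    = refl
head∷tail es (fsuc j) = refl

monoPath-ramsey : ∀ t → MonoPathRamsey t
monoPath-ramsey zero es c (x ∷ y ∷ V) unique uses (s≤s (s≤s _)) = ⊥-elim (uncolourable unique uses)
monoPath-ramsey (suc t) es c V unique uses big
  with AddColour.extend t (monoPath-ramsey t) c (Vector.head es) (Vector.tail es) V unique uses big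
... | j , a , path = j , a , subst (λ e → MonoPath c V e (toℕ j) a) (head∷tail es j) path

prod-positive : ∀ {t} (es : Fin t → ℕ) → (∀ i → 0 < es i) → 0 < prod es
prod-positive {zero}  es pos = s≤s z≤n
prod-positive {suc t} es pos = *-mono-≤ (pos fzero) (prod-positive (Vector.tail es) (λ i → pos (fsuc i)))

-- The lexicographic product colouring of [e_0 ⋯ e_t]: write x = x₀·Q + x'
-- with Q = e_1 ⋯ e_t; a pair whose leading digits increase gets colour 0,
-- otherwise the colouring recurses on the remainders.  (Q is written as
-- suc (pred Q) so that it is syntactically nonzero.)
blockSize : ∀ {t} → (Fin (suc t) → ℕ) → ℕ
blockSize es = suc (pred (prod (Vector.tail es)))

blockSize≡prod : ∀ {t} (es : Fin (suc t) → ℕ) → (∀ i → 0 < es i) → blockSize es ≡ prod (Vector.tail es)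
blockSize≡prod es pos =
  suc-pred _ {{>-nonZero (prod-positive (Vector.tail es) (λ i → pos (fsuc i)))}}

lexColouring : ∀ {t} → (Fin (suc t) → ℕ) → ℕ → ℕ → Fin (suc t)
lexColouring {zero}  es x y = fzero
lexColouring {suc t} es x y with x / blockSize es <? y / blockSize es
... | yes _ = fzero
... | no _  = fsuc (lexColouring (Vector.tail es) (x % blockSize es) (y % blockSize es))

lex-fzero : ∀ {t} (es : Fin (suc (suc t)) → ℕ) x y →
  lexColouring es x y ≡ fzero → x / blockSize es < y / blockSize es
lex-fzero es x y colour with x / blockSize es <? y / blockSize es
lex-fzero es x y colour | yes earlier = earlier
lex-fzero es x y ()     | no _

lex-fsuc : ∀ {t} (es : Fin (suc (suc t)) → ℕ) x y {j} → lexColouring es x y ≡ fsuc j →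
  ¬ x / blockSize es < y / blockSize es ×
  lexColouring (Vector.tail es) (x % blockSize es) (y % blockSize es) ≡ j
lex-fsuc es x y colour with x / blockSize es <? y / blockSize es
lex-fsuc es x y ()     | yes _
lex-fsuc es x y refl   | no not-earlier = not-earlier , refl

lex-short : ∀ {t} (es : Fin (suc t) → ℕ) → (∀ i → 0 < es i) → ∀ j n x →
  Chain (λ u v → lexColouring es u v ≡ j) n x → x n < prod es → n < es j
lex-short {zero} es _ fzero n x chain xn<P =
  ≤-<-trans (ascending⇒n≤ (λ r r<n → proj₁ (chain r r<n))) (subst (x n <_) (*-identityʳ (es fzero)) xn<P)
lex-short {suc t} es pos fzero n x chain xn<P =
  ≤-<-trans (ascending⇒n≤ digits-ascend)
            (m<n*o⇒m/o<n (subst (λ Q → x n < es fzero * Q) (sym (blockSize≡prod es pos)) xn<P))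
  where
  digits-ascend : Ascending n (λ r → x r / blockSize es)
  digits-ascend r r<n = lex-fzero es (x r) (x (suc r)) (proj₂ (chain r r<n))
lex-short {suc t} es pos (fsuc j) n x chain xn<P =
  lex-short (Vector.tail es) (λ i → pos (fsuc i)) j n (λ r → x r % blockSize es) remainders
            (subst (x n % blockSize es <_) (blockSize≡prod es pos) (m%n<n (x n) (blockSize es)))
  where
  remainders : Chain (λ u v → lexColouring (Vector.tail es) u v ≡ j) n (λ r → x r % blockSize es)
  remainders r r<n with chain r r<n
  ... | x<x' , colour with lex-fsuc es (x r) (x (suc r)) colour
  ...   | not-earlier , colour' = sameBlock⇒%< (blockSize es) x<x' same-digit , colour'
    where
    same-digit : x r / blockSize es ≡ x (suc r) / blockSize es
    same-digit = ≤-antisym (/-monoˡ-≤ (blockSize es) (<⇒≤ x<x')) (≮⇒≥ not-earlier)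

increasing-map : ∀ {n n' k} (f : Fin n → Fin n') → (∀ i j → toℕ i < toℕ j → toℕ (f i) < toℕ (f j)) →
  (v : Vec (Fin n) k) → Increasing v → Increasing (map f v)
increasing-map f f-mono []          _           = tt
increasing-map f f-mono (x ∷ [])    _           = tt
increasing-map f f-mono (x ∷ y ∷ v) (x<y , inc) = f-mono x y x<y , increasing-map f f-mono (y ∷ v) inc

increasing-tabulate : ∀ {n k} (g : Fin k → Fin n) →
  (∀ i j → toℕ i < toℕ j → toℕ (g i) < toℕ (g j)) → Increasing (tabulate g)
increasing-tabulate {k = zero}        g g-mono = tt
increasing-tabulate {k = suc zero}    g g-mono = tt
increasing-tabulate {k = suc (suc k)} g g-mono =
  g-mono fzero (fsuc fzero) (s≤s z≤n) ,
  increasing-tabulate (λ i → g (fsuc i)) (λ i j i<j → g-mono (fsuc i) (fsuc j) (s≤s i<j))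

increasing? : ∀ {n k} (v : Vec (Fin n) k) → Dec (Increasing v)
increasing? []          = yes tt
increasing? (x ∷ [])    = yes tt
increasing? (x ∷ y ∷ v) = (toℕ x <? toℕ y) ×-dec increasing? (y ∷ v)

toFinOr : ∀ {n} → Fin n → ℕ → Fin n
toFinOr {n} default q with q <? n
... | yes q<n = fromℕ< q<n
... | no _    = default

toℕ-toFinOr : ∀ {n} (default : Fin n) {q} → q < n → toℕ (toFinOr default q) ≡ q
toℕ-toFinOr {n} default {q} q<n with q <? n
... | yes q<n' = toℕ-fromℕ< q<n'
... | no q≮n   = ⊥-elim (q≮n q<n)

onℕ : ∀ {S N} → Fin S → (Fin S → Fin N) → ℕ → ℕ
onℕ origin f q = toℕ (f (toFinOr origin q))

stretch : ∀ {S N} (origin : Fin S) (f : Fin S → Fin N) →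
  (∀ i j → toℕ i < toℕ j → toℕ (f i) < toℕ (f j)) →
  ∀ q d → q + d < S → onℕ origin f q + d ≤ onℕ origin f (q + d)
stretch {S} origin f f-mono q d q+d<S = subst (λ z → u z + d ≤ u (q + d)) (+-identityʳ q)
    (ascending-gap (λ r → u (q + r)) d λ r r<d →
      subst (λ z → u (q + r) < u z) (sym (+-suc q r)) (u-step (≤-<-trans (+-monoʳ-< q r<d) q+d<S)))
  where
  u : ℕ → ℕ
  u = onℕ origin f
  u-step : ∀ {p} → suc p < S → u p < u (suc p)
  u-step {p} 1+p<S = f-mono (toFinOr origin p) (toFinOr origin (suc p))
    (subst₂ _<_ (sym (toℕ-toFinOr origin (<-trans (n<1+n p) 1+p<S)))
                (sym (toℕ-toFinOr origin 1+p<S)) (n<1+n p))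

-- The colour of a k-tuple of vertices as a number (0 if it is not an edge).
colourOf : ∀ {k N t} → Coloring k N t → Vec (Fin N) k → ℕ
colourOf c w with increasing? w
... | yes w-inc = toℕ (c w w-inc)
... | no _      = 0

colourOf< : ∀ {k N t} (c : Coloring k N (suc t)) w → colourOf c w < suc t
colourOf< c w with increasing? w
... | yes w-inc = toℕ<n (c w w-inc)
... | no _      = s≤s z≤n

colourOf-class : ∀ {k N t} (c : Coloring k N t) {j w} → Increasing w → colourOf c w ≡ toℕ j →
  Edge (ColorClass c j) w
colourOf-class c {j} {w} w-inc colour with increasing? w
... | yes w-inc' = w-inc' , toℕ-injective colour
... | no ¬inc    = ⊥-elim (¬inc w-inc)

module PathRamsey (k l : ℕ) (0<l : 0 < l) (2l≤k : 2 * l ≤ k) where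

  -- Consecutive edges of P_e^{k,l} start m apart.
  m : ℕ
  m = k ∸ l

  l+l≤k : l + l ≤ k
  l+l≤k = subst (_≤ k) (cong (l +_) (+-identityʳ l)) 2l≤k

  l≤m : l ≤ m
  l≤m = m+n≤o⇒m≤o∸n l l+l≤k

  m+l≡k : m + l ≡ k
  m+l≡k = m∸n+n≡m (≤-trans (m≤m+n l l) l+l≤k)

  0<m : 0 < m
  0<m = <-≤-trans 0<l l≤m

  instance
    m-nonZero : NonZero m
    m-nonZero = >-nonZero 0<m
    l-nonZero : NonZero l
    l-nonZero = >-nonZero 0<l

  m<k : m < k
  m<k = subst (m <_) m+l≡k (m<m+n m 0<l)

  0<k : 0 < k
  0<k = <-trans 0<m m<k

  edge-vertex< : ∀ {e r i} → r < e → i < k → r * m + i < e * m + l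
  edge-vertex< {e} {r} {i} r<e i<k = begin-strict
      r * m + i        <⟨ +-monoʳ-< (r * m) i<k ⟩
      r * m + k        ≡⟨ cong (r * m +_) (sym m+l≡k) ⟩
      r * m + (m + l)  ≡⟨ sym (+-assoc (r * m) m l) ⟩
      r * m + m + l    ≡⟨ cong (_+ l) (+-comm (r * m) m) ⟩
      suc r * m + l    ≤⟨ +-monoˡ-≤ l (*-monoˡ-≤ m r<e) ⟩
      e * m + l        ∎
    where open ≤-Reasoning

  vertex-block≤ : ∀ {e q} → q < e * m + l → q / m ≤ e
  vertex-block≤ {e} {q} q<S = ≤-pred (m<n*o⇒m/o<n (begin-strict
      q          <⟨ q<S ⟩
      e * m + l  ≤⟨ +-monoʳ-≤ (e * m) l≤m ⟩
      e * m + m  ≡⟨ +-comm (e * m) m ⟩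
      suc e * m  ∎))
    where open ≤-Reasoning

  blockPair : ℕ → ℕ → ℕ → ℕ
  blockPair x y i with i <? m
  ... | yes _ = x * m + i
  ... | no _  = y * m + (i ∸ m)

  blowUp : (ℕ → ℕ) → ℕ → ℕ
  blowUp a q = a (q / m) * m + q % m

  blowUp-edge : ∀ a r i → i < k → blowUp a (r * m + i) ≡ blockPair (a r) (a (suc r)) i
  blowUp-edge a r i i<k with i <? m
  ... | yes i<m = cong₂ (λ x s → a x * m + s) ([q*d+s]/d≡q m r i i<m) ([q*d+s]%d≡s m r i i<m)
  ... | no i≮m = begin
      blowUp a (r * m + i)             ≡⟨ cong (blowUp a) shift ⟩
      blowUp a (suc r * m + (i ∸ m))   ≡⟨ cong₂ (λ x s → a x * m + s) ([q*d+s]/d≡q m (suc r) (i ∸ m) i∸m<m)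
                                                                      ([q*d+s]%d≡s m (suc r) (i ∸ m) i∸m<m) ⟩
      a (suc r) * m + (i ∸ m)          ∎
    where
    open ≡-Reasoning
    m+[i∸m]≡i : m + (i ∸ m) ≡ i
    m+[i∸m]≡i = m+[n∸m]≡n (≮⇒≥ i≮m)
    i∸m<m : i ∸ m < m
    i∸m<m = <-≤-trans (+-cancelˡ-< m (i ∸ m) l (subst₂ _<_ (sym m+[i∸m]≡i) (sym m+l≡k) i<k)) l≤m
    shift : r * m + i ≡ suc r * m + (i ∸ m)
    shift = trans (cong (r * m +_) (sym m+[i∸m]≡i))
                  (trans (sym (+-assoc (r * m) m (i ∸ m))) (cong (_+ (i ∸ m)) (+-comm (r * m) m)))

  blowUp-mono : ∀ a e → Ascending e a → ∀ {q q'} → q < q' → q' / m ≤ e → blowUp a q < blowUp a q'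
  blowUp-mono a e asc {q} {q'} q<q' q'/m≤e with m≤n⇒m<n∨m≡n (/-monoˡ-≤ m (<⇒≤ q<q'))
  ... | inj₂ same = subst (λ z → a (q / m) * m + q % m < a z * m + q' % m) same
                          (+-monoʳ-< (a (q / m) * m) (sameBlock⇒%< m q<q' same))
  ... | inj₁ earlier = begin-strict
      a (q / m) * m + q % m  <⟨ +-monoʳ-< (a (q / m) * m) (m%n<n q m) ⟩
      a (q / m) * m + m      ≡⟨ +-comm (a (q / m) * m) m ⟩
      suc (a (q / m)) * m    ≤⟨ *-monoˡ-≤ m (ascending⇒< asc earlier q'/m≤e) ⟩
      a (q' / m) * m         ≤⟨ m≤m+n _ _ ⟩
      blowUp a q'            ∎
    where open ≤-Reasoning

  blowUp< : ∀ a e P → Ascending e a → a e ≤ P → ∀ {q} → q < e * m + l → blowUp a q < m * P + l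
  blowUp< a e P asc ae≤P {q} q<S = ≤-<-trans blowUp-q≤top top-inside
    where
    top : ℕ
    top = e * m + pred l
    top<S : top < e * m + l
    top<S = +-monoʳ-< (e * m) (m≤pred[n]⇒suc[m]≤n ≤-refl)
    q≤top : q ≤ top
    q≤top = ≤-pred (subst (q <_) (trans (cong (e * m +_) (sym (suc-pred l))) (+-suc (e * m) (pred l))) q<S)
    blowUp-q≤top : blowUp a q ≤ blowUp a top
    blowUp-q≤top with m≤n⇒m<n∨m≡n q≤top
    ... | inj₁ q<top = <⇒≤ (blowUp-mono a e asc q<top (vertex-block≤ top<S))
    ... | inj₂ refl  = ≤-refl
    pred-l<m : pred l < m
    pred-l<m = <-≤-trans (m≤pred[n]⇒suc[m]≤n ≤-refl) l≤m
    top-inside : blowUp a top < m * P + l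
    top-inside = begin-strict
      blowUp a top       ≡⟨ cong₂ (λ x s → a x * m + s) ([q*d+s]/d≡q m e (pred l) pred-l<m)
                                                        ([q*d+s]%d≡s m e (pred l) pred-l<m) ⟩
      a e * m + pred l   ≤⟨ +-monoˡ-≤ (pred l) (*-monoˡ-≤ m ae≤P) ⟩
      P * m + pred l     <⟨ +-monoʳ-< (P * m) (m≤pred[n]⇒suc[m]≤n ≤-refl) ⟩
      P * m + l          ≡⟨ cong (_+ l) (*-comm P m) ⟩
      m * P + l          ∎
      where open ≤-Reasoning

  -- Upper bound: a t-colouring of K^k on m·P + l vertices induces a colouring
  -- of the pairs of blocks 0, …, P, and a monochromatic graph path blows up
  -- to a monochromatic copy of the path.
  module UpperBound {t} (es : Fin (suc t) → ℕ) (c : Coloring k (m * prod es + l) (suc t)) where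

    P N : ℕ
    P = prod es
    N = m * P + l

    origin : Fin N
    origin = fromℕ< (<-≤-trans 0<l (m≤n+m l (m * P)))

    blockEdge : ℕ → ℕ → Vec (Fin N) k
    blockEdge x y = tabulate (λ i → toFinOr origin (blockPair x y (toℕ i)))

    pairColour : PairColouring
    pairColour x y = colourOf c (blockEdge x y)

    monochromatic-path : HasMonoPath es pairColour (downFrom (suc P))
    monochromatic-path =
      monoPath-ramsey (suc t) es pairColour (downFrom (suc P)) (downFrom⁺ (suc P))
        (λ x y _ _ _ → colourOf< c (blockEdge x y))
        (subst (P <_) (sym (length-downFrom (suc P))) (n<1+n P))

    embedding : ∀ j a → MonoPath pairColour (downFrom (suc P)) (es j) (toℕ j) a →
      Contained (Path (es j) k l) (ColorClass c j)
    embedding j a (inV , chain) = f , f-mono , f-edges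
      where
      e : ℕ
      e = es j
      asc : Ascending e a
      asc r r<e = proj₁ (chain r r<e)
      ae≤P : a e ≤ P
      ae≤P = ≤-pred (∈-downFrom⁻ (inV e ≤-refl))
      f : Fin (e * m + l) → Fin N
      f p = fromℕ< (blowUp< a e P asc ae≤P (toℕ<n p))
      toℕ-f : ∀ p → toℕ (f p) ≡ blowUp a (toℕ p)
      toℕ-f p = toℕ-fromℕ< _
      f-mono : ∀ p p' → toℕ p < toℕ p' → toℕ (f p) < toℕ (f p')
      f-mono p p' p<p' = subst₂ _<_ (sym (toℕ-f p)) (sym (toℕ-f p'))
                                   (blowUp-mono a e asc p<p' (vertex-block≤ (toℕ<n p')))
      f-edges : ∀ v → Increasing v → Edge (Path e k l) v → Edge (ColorClass c j) (map f v)
      f-edges v v-inc (r , v≡A_r) =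
        colourOf-class c (increasing-map f f-mono v v-inc)
          (trans (cong (colourOf c) image) (proj₂ (chain (toℕ r) (toℕ<n r))))
        where
        open ≡-Reasoning
        vertex : ∀ i → toℕ (f (lookup v i)) ≡ blockPair (a (toℕ r)) (a (suc (toℕ r))) (toℕ i)
        vertex i = begin
          toℕ (f (lookup v i))            ≡⟨ toℕ-f (lookup v i) ⟩
          blowUp a (toℕ (lookup v i))     ≡⟨ cong (blowUp a) (v≡A_r i) ⟩
          blowUp a (toℕ r * m + toℕ i)    ≡⟨ blowUp-edge a (toℕ r) (toℕ i) (toℕ<n i) ⟩
          blockPair (a (toℕ r)) (a (suc (toℕ r))) (toℕ i) ∎
        image : map f v ≡ blockEdge (a (toℕ r)) (a (suc (toℕ r)))
        image = trans (sym (tabulate∘lookup (map f v))) (tabulate-cong λ i → toℕ-injective (begin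
          toℕ (lookup (map f v) i)  ≡⟨ cong toℕ (lookup-map i f v) ⟩
          toℕ (f (lookup v i))      ≡⟨ vertex i ⟩
          blockPair (a (toℕ r)) (a (suc (toℕ r))) (toℕ i)
            ≡⟨ toℕ-toFinOr origin (subst (_< N) (vertex i) (toℕ<n (f (lookup v i)))) ⟨
          toℕ (toFinOr origin (blockPair (a (toℕ r)) (a (suc (toℕ r))) (toℕ i))) ∎))

  upper : ∀ {t} (es : Fin (suc t) → ℕ) → Arrows (m * prod es + l) (λ i → Path (es i) k l)
  upper es c with UpperBound.monochromatic-path es c
  ... | j , a , path = j , UpperBound.embedding es c j a path

  -- The edge A_r of P_e^{k,l} as a vector of vertices (meaningful for r < e).
  pathOrigin : ∀ e → Fin (e * m + l)
  pathOrigin e = fromℕ< (<-≤-trans 0<l (m≤n+m l (e * m)))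

  pathEdge : ∀ e → ℕ → Vec (Fin (e * m + l)) k
  pathEdge e r = tabulate (λ i → toFinOr (pathOrigin e) (r * m + toℕ i))

  pathEdge-vertex : ∀ {e r} → r < e → ∀ i → toℕ (lookup (pathEdge e r) i) ≡ r * m + toℕ i
  pathEdge-vertex {e} r<e i =
    trans (cong toℕ (lookup∘tabulate _ i)) (toℕ-toFinOr (pathOrigin e) (edge-vertex< r<e (toℕ<n i)))

  pathEdge-inc : ∀ {e r} → r < e → Increasing (pathEdge e r)
  pathEdge-inc {e} {r} r<e = increasing-tabulate _ λ i i' i<i' →
    subst₂ _<_ (sym (toℕ-toFinOr (pathOrigin e) (edge-vertex< r<e (toℕ<n i))))
               (sym (toℕ-toFinOr (pathOrigin e) (edge-vertex< r<e (toℕ<n i')))) (+-monoʳ-< (r * m) i<i')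

  pathEdge-edge : ∀ {e r} → r < e → Edge (Path e k l) (pathEdge e r)
  pathEdge-edge r<e = fromℕ< r<e , λ i →
    trans (pathEdge-vertex r<e i) (cong (λ z → z * m + toℕ i) (sym (toℕ-fromℕ< r<e)))

  lexHyperColouring : ∀ {t N} → (Fin (suc t) → ℕ) → Coloring k N (suc t)
  lexHyperColouring es v _ =
    lexColouring es (toℕ (lookup v (fromℕ< 0<k)) / m) (toℕ (lookup v (fromℕ< m<k)) / m)

  -- An embedding of P_e^{k,l} into colour j of the lexicographic colouring on
  -- N vertices gives a colour-j lexicographic graph path x with e edges, namely
  -- the blocks of the images of the vertices r·m, with x e · m + l ≤ N.
  embedding⇒lexPath : ∀ {t N} (es : Fin (suc t) → ℕ) j e →
    Contained (Path e k l) (ColorClass (lexHyperColouring {N = N} es) j) →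
    Σ (ℕ → ℕ) λ x → Chain (λ u v → lexColouring es u v ≡ j) e x × x e * m + l ≤ N
  embedding⇒lexPath {N = N} es j e (f , f-mono , f-edges) = x , chain , bound
    where
    u : ℕ → ℕ
    u = onℕ (pathOrigin e) f
    u-gap : ∀ q d → q + d < e * m + l → u q + d ≤ u (q + d)
    u-gap = stretch (pathOrigin e) f f-mono
    image-vertex : ∀ r i → toℕ (lookup (map f (pathEdge e r)) i) ≡ u (r * m + toℕ i)
    image-vertex r i =
      trans (cong toℕ (lookup-map i f (pathEdge e r))) (cong (λ p → toℕ (f p)) (lookup∘tabulate _ i))
    x : ℕ → ℕ
    x r = u (r * m) / m
    chain : Chain (λ a b → lexColouring es a b ≡ j) e x
    chain r r<e = x-step , colour
      where
      x-step : x r < x (suc r)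
      x-step = begin-strict
        u (r * m) / m        <⟨ n<1+n _ ⟩
        suc (u (r * m) / m)  ≡⟨ [x+d]/d≡1+x/d m (u (r * m)) ⟨
        (u (r * m) + m) / m  ≤⟨ /-monoˡ-≤ m (u-gap (r * m) m (edge-vertex< r<e m<k)) ⟩
        u (r * m + m) / m    ≡⟨ cong (λ z → u z / m) (+-comm (r * m) m) ⟩
        x (suc r)            ∎
        where open ≤-Reasoning
      first-block : toℕ (lookup (map f (pathEdge e r)) (fromℕ< 0<k)) / m ≡ x r
      first-block = cong (_/ m) (trans (image-vertex r _)
        (cong u (trans (cong (r * m +_) (toℕ-fromℕ< 0<k)) (+-identityʳ (r * m)))))
      next-block : toℕ (lookup (map f (pathEdge e r)) (fromℕ< m<k)) / m ≡ x (suc r)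
      next-block = cong (_/ m) (trans (image-vertex r _)
        (cong u (trans (cong (r * m +_) (toℕ-fromℕ< m<k)) (+-comm (r * m) m))))
      colour : lexColouring es (x r) (x (suc r)) ≡ j
      colour = subst₂ (λ a b → lexColouring es a b ≡ j) first-block next-block
        (proj₂ (f-edges (pathEdge e r) (pathEdge-inc r<e) (pathEdge-edge r<e)))
    bound : x e * m + l ≤ N
    bound = begin
      x e * m + l                 ≤⟨ +-monoˡ-≤ l (m/n*n≤m (u (e * m)) m) ⟩
      u (e * m) + l               ≡⟨ cong (u (e * m) +_) (sym (suc-pred l)) ⟩
      u (e * m) + suc (pred l)    ≡⟨ +-suc (u (e * m)) (pred l) ⟩
      suc (u (e * m) + pred l)    ≤⟨ s≤s (u-gap (e * m) (pred l) (+-monoʳ-< (e * m) (m≤pred[n]⇒suc[m]≤n ≤-refl))) ⟩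
      suc (u (e * m + pred l))    ≤⟨ toℕ<n (f _) ⟩
      N                           ∎
      where open ≤-Reasoning

  -- No N < m·e_1⋯e_t + l arrows the paths: the lexicographic colouring would
  -- contain a colour-j graph path with e_j edges below e_1⋯e_t.
  lower : ∀ {t} (es : Fin (suc t) → ℕ) → (∀ i → 0 < es i) → ∀ N → N < m * prod es + l →
    ¬ Arrows N (λ i → Path (es i) k l)
  lower es pos N N<bound arrows with arrows (lexHyperColouring es)
  ... | j , copy with embedding⇒lexPath es j (es j) copy
  ...   | x , chain , bound = <-irrefl refl (lex-short es pos j (es j) x chain x<P)
    where
    x<P : x (es j) < prod es
    x<P = *-cancelʳ-< m (x (es j)) (prod es) (+-cancelʳ-< l (x (es j) * m) (prod es * m)
      (subst (λ z → x (es j) * m + l < z + l) (*-comm m (prod es)) (≤-<-trans bound N<bound)))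

corollary2 : (k l t : ℕ) → (es : Fin t → ℕ) → 0 < l → 2 * l ≤ k → 0 < t → (∀ i → 0 < es i) → IsOrderedRamsey (λ i → Path (es i) k l) ((k ∸ l) * prod es + l)
corollary2 k l zero    es 0<l 2l≤k ()  pos
corollary2 k l (suc t) es 0<l 2l≤k _ pos = upper es , λ N N<R → lower es pos N N<R
  where open PathRamsey k l 0<l 2l≤k
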